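{- Let $\mathcal T\in\Sigma^n$ be a text, $\pi$ an order-preserving permutation for $\mathcal T$, and $P\in(\Sigma\setminus\{\$\})^m$. Consider the following algorithm. Set $i\gets\pi^{ -1}(1)$ and $j\gets1$. While $j\le m$: if $\mathcal T[i]\neq P[j]$, then compute $[b,e]\gets\mathrm{sufsearch}(i-j+1,i-1,P[j])$, let $i'\in[b,e]$ minimize $\pi(\mathrm{PDA}_\pi[i'])$, and set $i\gets\mathrm{PDA}_\pi[i']$; then (in either case) set $i\gets i+1$, $j\gets j+1$. After the loop, if $\mathcal T[i-m,i-1]=P$ return $i-m$, otherwise return NOT\_FOUND. This algorithm is correct and complete: if $P$ occurs in $\mathcal T$ it returns the position $i$ with $\mathcal T[i,i+m-1]=P$ minimizing $\pi(i)$ among all occurrences of $P$, and if $P$ does not occur in $\mathcal T$ it returns NOT\_FOUND.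
   Context: A text is a string $\mathcal T\in\Sigma^n$ (1-indexed) whose last symbol $\$$ occurs only at position $n$ and is smaller than all other symbols. $\mathrm{rlce}(i,j)$ is the length of the longest common prefix of $\mathcal T[i,n],\mathcal T[j,n]$. A permutation $\pi$ of $[n]$ is order-preserving for $\mathcal T$ if for all $i,j\in[n-1]$, $\pi(i)<\pi(j)$ and $\mathcal T[i,i+1]=\mathcal T[j,j+1]$ imply $\pi(i+1)<\pi(j+1)$. $\mathrm{LPF}_\pi[i]=0$ if $\pi(i)=1$, else $\max_{j:\pi(j)<\pi(i)}\mathrm{rlce}(j,i)$. $\mathrm{PDA}_\pi$ is the array of distinct values $\{i+\mathrm{LPF}_\pi[i]:i\in[n]\}$ sorted by colexicographic order of the prefixes $\mathcal T[1,j]$. For $(i,j,c)$, $\mathrm{sufsearch}(i,j,c)$ returns the maximal range $[b,e]\subseteq[|\mathrm{PDA}_\pi|]$ such that $\mathcal T[1,\mathrm{PDA}_\pi[t]]$ has suffix $\mathcal T[i,j]\cdot c$ for all $t\in[b,e]$ (when no such $t$ exists, it may return an arbitrary nonempty range). -}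

module Defs where

open import Data.Nat using (ℕ; zero; suc; _+_; _∸_; _≤_; _<_; _⊔_; _<ᵇ_; _≡ᵇ_)
open import Data.Bool using (Bool; true; false; if_then_else_; _∧_; _∨_)
open import Data.List using (List; []; _∷_; length; map; foldr; upTo)
open import Data.Bool.ListAction using (and)
open import Data.List.Relation.Unary.Linked using (Linked)
open import Data.List.Membership.Propositional using (_∈_)
open import Data.Product using (Σ; ∃; _×_; _,_; proj₁; proj₂)
open import Data.Sum using (_⊎_)
open import Data.Maybe using (Maybe; just; nothing)
open import Relation.Binary.PropositionalEquality using (_≡_; _≢_)
open import Relation.Nullary using (¬_)

-- The alphabet Σ is ℕ with its usual order; the end marker $ is the
-- symbol 0 (smallest symbol).  Strings (text T, pattern P) are lists,
-- accessed 1-indexed with `at`; reading outside [1, length] yields 0.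

at : List ℕ → ℕ → ℕ
at []       _             = 0
at (x ∷ xs) zero          = 0
at (x ∷ xs) (suc zero)    = x
at (x ∷ xs) (suc (suc k)) = at xs (suc k)

range1 : ℕ → List ℕ
range1 n = map suc (upTo n)

maxList : List ℕ → ℕ
maxList = foldr _⊔_ 0

IsText : List ℕ → Set
IsText T = (1 ≤ length T) × (at T (length T) ≡ 0)
         × (∀ k → 1 ≤ k → k < length T → at T k ≢ 0)

IsPerm : ℕ → (ℕ → ℕ) → Set
IsPerm n π = (∀ i → 1 ≤ i → i ≤ n → (1 ≤ π i) × (π i ≤ n))
           × (∀ i j → 1 ≤ i → i ≤ n → 1 ≤ j → j ≤ n → π i ≡ π j → i ≡ j)

preimage : (ℕ → ℕ) → ℕ → ℕ → ℕ
preimage π n v = go (range1 n)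
  where
  go : List ℕ → ℕ
  go []       = 0
  go (i ∷ is) = if π i ≡ᵇ v then i else go is

OrderPreserving : List ℕ → (ℕ → ℕ) → Set
OrderPreserving T π =
  ∀ i j → 1 ≤ i → i ≤ length T ∸ 1 → 1 ≤ j → j ≤ length T ∸ 1 →
  π i < π j → at T i ≡ at T j → at T (suc i) ≡ at T (suc j) →
  π (suc i) < π (suc j)

lcpFuel : List ℕ → ℕ → ℕ → ℕ → ℕ
lcpFuel T zero    i j = 0
lcpFuel T (suc f) i j =
  if (0 <ᵇ i) ∧ (0 <ᵇ j) ∧ (i <ᵇ suc (length T)) ∧ (j <ᵇ suc (length T))
     ∧ (at T i ≡ᵇ at T j)
  then suc (lcpFuel T f (suc i) (suc j)) else 0

-- the fuel n suffices: the lcp of two suffixes of T is at most n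
rlce : List ℕ → ℕ → ℕ → ℕ
rlce T i j = lcpFuel T (length T) i j

LPF : List ℕ → (ℕ → ℕ) → ℕ → ℕ
LPF T π i =
  if π i ≡ᵇ 1 then 0
  else maxList (map (λ j → if π j <ᵇ π i then rlce T j i else 0)
                    (range1 (length T)))

-- strict colexicographic order of the prefixes T[1,p] and T[1,q]
-- (compare from the last symbol; a proper suffix comes first)
colexLtᵇ : List ℕ → ℕ → ℕ → Bool
colexLtᵇ T zero    zero    = false
colexLtᵇ T zero    (suc q) = true
colexLtᵇ T (suc p) zero    = false
colexLtᵇ T (suc p) (suc q) =
  (at T (suc p) <ᵇ at T (suc q))
  ∨ ((at T (suc p) ≡ᵇ at T (suc q)) ∧ colexLtᵇ T p q)

ColexLt : List ℕ → ℕ → ℕ → Set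
ColexLt T p q = colexLtᵇ T p q ≡ true

IsPDA : List ℕ → (ℕ → ℕ) → List ℕ → Set
IsPDA T π D =
  Linked (ColexLt T) D
  × (∀ x → (x ∈ D) → Σ ℕ (λ i → (1 ≤ i) × (i ≤ length T) × (x ≡ i + LPF T π i)))
  × (∀ i → 1 ≤ i → i ≤ length T → (i + LPF T π i) ∈ D)

-- T[1, PDA[t]] has suffix T[a,b]·c
SufMatch : List ℕ → List ℕ → ℕ → ℕ → ℕ → ℕ → Set
SufMatch T D a b c t =
  let p = at D t
      L = suc b ∸ a
  in (suc L ≤ p) × (at T p ≡ c) × (∀ k → k < L → at T (p ∸ L + k) ≡ at T (a + k))

SufSearchSpec : List ℕ → List ℕ → (ℕ → ℕ → ℕ → ℕ × ℕ) → Set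
SufSearchSpec T D ss =
  ∀ a b c →
    let lo = proj₁ (ss a b c)
        hi = proj₂ (ss a b c)
    in (1 ≤ lo) × (lo ≤ hi) × (hi ≤ length D)
       × (1 ≤ a → a ≤ suc b → b ≤ length T →
          Σ ℕ (λ t → (1 ≤ t) × (t ≤ length D) × SufMatch T D a b c t) →
            (∀ t → lo ≤ t → t ≤ hi → SufMatch T D a b c t)
            × ((lo ≡ 1) ⊎ ¬ SufMatch T D a b c (lo ∸ 1))
            × ((hi ≡ length D) ⊎ ¬ SufMatch T D a b c (suc hi)))

aminFrom : (ℕ → ℕ) → ℕ → ℕ → ℕ
aminFrom f b zero    = b
aminFrom f b (suc k) =
  let r = aminFrom f (suc b) k in if f r <ᵇ f b then r else b

argminRange : (ℕ → ℕ) → ℕ → ℕ → ℕ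
argminRange f b e = aminFrom f b (e ∸ b)

module Algorithm (T : List ℕ) (π : ℕ → ℕ) (D : List ℕ)
                 (ss : ℕ → ℕ → ℕ → ℕ × ℕ) (P : List ℕ) where

  m : ℕ
  m = length P

  jump : ℕ → ℕ → ℕ
  jump i j =
    let r  = ss (suc i ∸ j) (i ∸ 1) (at P j)
        i' = argminRange (λ t → π (at D t)) (proj₁ r) (proj₂ r)
    in at D i'

  step : ℕ → ℕ → ℕ
  step i j = suc (if at T i ≡ᵇ at P j then i else jump i j)

  loop : ℕ → ℕ → ℕ → ℕ
  loop zero    i j = i
  loop (suc k) i j = loop k (step i j) (suc j)

  finalI : ℕ
  finalI = loop m (preimage π (length T) 1) 1

  matchesAt : ℕ → Bool
  matchesAt k = and (map (λ t → at T (k + t) ≡ᵇ at P (suc t)) (upTo m))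

  result : Maybe ℕ
  result = if (m <ᵇ finalI) ∧ matchesAt (finalI ∸ m)
           then just (finalI ∸ m) else nothing

Occ : List ℕ → List ℕ → ℕ → Set
Occ T P k = (1 ≤ k) × (k ≤ length T) × (k + length P ≤ suc (length T))
          × (∀ t → t < length P → at T (k + t) ≡ at P (suc t))

MinOcc : List ℕ → (ℕ → ℕ) → List ℕ → ℕ → Set
MinOcc T π P k = Occ T P k × (∀ k' → Occ T P k' → π k ≤ π k')

{-# OPTIONS --safe #-}
-- Loop invariant: after j iterations i = k + j, where k is the π-least occurrence of P[1, j]
-- (for j = 0 every position qualifies, so k = π⁻¹(1)).  A matching symbol keeps k.  On a
-- mismatch let k′ be the π-least occurrence of P[1, j + 1]; then π k < π k′ and k′ has longest
-- previous factor exactly j, so k′ + j is an entry of PDA.  Every PDA entry ending with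
-- T[k, k + j - 1] · P[j + 1] is d + j for an occurrence d of P[1, j + 1], and for d ≠ k′ order
-- preservation propagates π k′ < π d to π (k′ + j) < π (d + j).  The sufsearch range contains
-- k′ + j because entries with a common suffix are contiguous in colex order, so its π-least
-- entry is k′ + j.
module Submission where

open import Defs
open import Data.Nat
open import Data.Nat.Properties
open import Data.Bool using (true; false; if_then_else_; _∧_)
import Data.Bool as Bool
open import Data.List using (List; []; _∷_; length; upTo; filter)
open import Data.List.Properties using (foldr-preservesᵇ)
open import Data.List.Relation.Unary.All as All using (All)
import Data.List.Relation.Unary.All.Properties as Allₚ
open import Data.List.Relation.Unary.Any using (here; there)
open import Data.List.Relation.Unary.AllPairs using (AllPairs; _∷_)
open import Data.List.Relation.Unary.Linked as Linked using (Linked)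
open import Data.List.Relation.Unary.Linked.Properties using (Linked⇒AllPairs)
open import Data.List.Membership.Propositional using (_∈_)
open import Data.List.Membership.Propositional.Properties
  using (∈-map⁺; ∈-map⁻; ∈-upTo⁺; ∈-upTo⁻; ∈-filter⁺)
open import Data.List.Extrema.Nat using (argmin; argmin-all; f[argmin]≤f[xs])
open import Data.Fin using (Fin; toℕ; fromℕ<; punchOut)
open import Data.Fin.Properties using (any?; pigeonhole; toℕ<n; toℕ-fromℕ<; punchOut-injective)
import Data.Fin.Properties as Finₚ
open import Data.Product using (Σ; ∃; ∃-syntax; _×_; _,_; proj₁; proj₂)
open import Data.Sum using (_⊎_; inj₁; inj₂)
open import Data.Maybe using (Maybe; just; nothing)
open import Function.Bundles using (_⇔_; mk⇔; Equivalence)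
open import Relation.Binary.PropositionalEquality
open import Function using (_∘_; case_of_)
open import Relation.Nullary using (¬_; Dec; yes; no; contradiction)
open import Relation.Nullary.Decidable using (map′; _×-dec_; decidable-stable)

≡true⇒T : ∀ {b} → b ≡ true → Bool.T b
≡true⇒T refl = _

≡false⇒¬T : ∀ {b} → b ≡ false → ¬ Bool.T b
≡false⇒¬T refl ()

T⇒≡true : ∀ {b} → Bool.T b → b ≡ true
T⇒≡true {true} _ = refl

T-∧ˡ : ∀ {a b} → Bool.T (a ∧ b) → Bool.T a
T-∧ˡ {true} _ = _

T-∧ʳ : ∀ a {b} → Bool.T (a ∧ b) → Bool.T b
T-∧ʳ true Tb = Tb

at-∈ : ∀ xs {t} → 1 ≤ t → t ≤ length xs → at xs t ∈ xs
at-∈ (x ∷ xs) {1}           _ _          = here refl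
at-∈ (x ∷ xs) {suc (suc t)} _ (s≤s t≤∣xs∣) = there (at-∈ xs (s≤s z≤n) t≤∣xs∣)

∈⇒at : ∀ {x : ℕ} {xs} → x ∈ xs → ∃[ t ] 1 ≤ t × t ≤ length xs × at xs t ≡ x
∈⇒at (here refl) = 1 , s≤s z≤n , s≤s z≤n , refl
∈⇒at (there x∈xs) with ∈⇒at x∈xs
... | suc t , _ , t≤∣xs∣ , xs[t]≡x = suc (suc t) , s≤s z≤n , s≤s t≤∣xs∣ , xs[t]≡x

at≢0⇒inBounds : ∀ xs {t} → at xs t ≢ 0 → 1 ≤ t × t ≤ length xs
at≢0⇒inBounds []       xs[t]≢0 = contradiction refl xs[t]≢0
at≢0⇒inBounds (x ∷ xs) {zero}        xs[t]≢0 = contradiction refl xs[t]≢0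
at≢0⇒inBounds (x ∷ xs) {1}           _       = s≤s z≤n , s≤s z≤n
at≢0⇒inBounds (x ∷ xs) {suc (suc t)} xs[t]≢0 = s≤s z≤n , s≤s (proj₂ (at≢0⇒inBounds xs xs[t]≢0))

AllPairs-at : ∀ {R : ℕ → ℕ → Set} {xs} → AllPairs R xs →
              ∀ {t₁ t₂} → 1 ≤ t₁ → t₁ < t₂ → t₂ ≤ length xs → R (at xs t₁) (at xs t₂)
AllPairs-at (_ ∷ _) {1} {1} _ (s≤s ()) _
AllPairs-at {xs = x ∷ xs} (Rx ∷ _)  {1} {suc (suc t₂)} _ _ (s≤s t₂≤∣xs∣) =
  All.lookup Rx (at-∈ xs (s≤s z≤n) t₂≤∣xs∣)
AllPairs-at {xs = x ∷ xs} (_ ∷ Rxs) {suc (suc t₁)} {suc (suc t₂)} _ (s≤s t₁<t₂) (s≤s t₂≤∣xs∣) =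
  AllPairs-at Rxs (s≤s z≤n) t₁<t₂ t₂≤∣xs∣

∈-range1⁺ : ∀ {x n} → 1 ≤ x → x ≤ n → x ∈ range1 n
∈-range1⁺ {suc x} _ x≤n = ∈-map⁺ suc (∈-upTo⁺ x≤n)

∈-range1⁻ : ∀ {x n} → x ∈ range1 n → 1 ≤ x × x ≤ n
∈-range1⁻ x∈ with ∈-map⁻ suc x∈
... | _ , y∈ , refl = s≤s z≤n , ∈-upTo⁻ y∈

maxList-lub : ∀ {v xs} → All (_≤ v) xs → maxList xs ≤ v
maxList-lub = foldr-preservesᵇ ⊔-lub z≤n

≤-maxList : ∀ {x xs} → x ∈ xs → x ≤ maxList xs
≤-maxList {xs = y ∷ ys} (here refl) = m≤m⊔n y (maxList ys)
≤-maxList {xs = y ∷ ys} (there x∈)  = ≤-trans (≤-maxList x∈) (m≤n⊔m y (maxList ys))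

search-spec : ∀ (π : ℕ → ℕ) v (search : List ℕ → ℕ) →
              (∀ i is → search (i ∷ is) ≡ (if π i ≡ᵇ v then i else search is)) →
              ∀ {x xs} → x ∈ xs → π x ≡ v → search xs ∈ xs × π (search xs) ≡ v
search-spec π v search search-∷ {x} {i ∷ is} x∈ πx≡v rewrite search-∷ i is
  with π i ≡ᵇ v in πi≡ᵇv | x∈
... | true  | _ = here refl , ≡ᵇ⇒≡ (π i) v (≡true⇒T πi≡ᵇv)
... | false | here refl = contradiction (≡⇒≡ᵇ (π i) v πx≡v) (≡false⇒¬T πi≡ᵇv)
... | false | there x∈is with search-spec π v search search-∷ x∈is πx≡v
...   | found∈is , πfound≡v = there found∈is , πfound≡v

-- `preimage` runs a search loop local to its definition; unification names it.
module _ (π : ℕ → ℕ) (n v : ℕ) where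
  private
    mutual
      search : List ℕ → ℕ
      search = _

      preimage≡search : preimage π n v ≡ search (range1 n)
      preimage≡search with range1 n
      ... | xs = refl

  preimage-spec : ∀ {x} → 1 ≤ x → x ≤ n → π x ≡ v →
                  1 ≤ preimage π n v × preimage π n v ≤ n × π (preimage π n v) ≡ v
  preimage-spec 1≤x x≤n πx≡v rewrite preimage≡search
    with search-spec π v search (λ _ _ → refl) (∈-range1⁺ 1≤x x≤n) πx≡v
  ... | found∈ , πfound≡v = proj₁ (∈-range1⁻ found∈) , proj₂ (∈-range1⁻ found∈) , πfound≡v

Fin-injective⇒surjective : ∀ {m} (f : Fin m → Fin m) → (∀ {x y} → f x ≡ f y → x ≡ y) →
                           ∀ y → ∃[ x ] f x ≡ y
Fin-injective⇒surjective {suc m} f f-injective y with any? (λ x → f x Finₚ.≟ y)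
... | yes hit = hit
... | no ∄x = contradiction (pigeonhole (n<1+n m) squeeze) λ (x₁ , x₂ , x₁<x₂ , squeeze≡) →
  Finₚ.<-irrefl (f-injective (punchOut-injective (y≢f x₁) (y≢f x₂) squeeze≡)) x₁<x₂
  where
  y≢f : ∀ x → y ≢ f x
  y≢f x y≡fx = ∄x (x , sym y≡fx)

  squeeze : Fin (suc m) → Fin m
  squeeze x = punchOut (y≢f x)

module _ {n π} (perm : IsPerm n π) where
  private
    fin : ∀ {w} → 1 ≤ w → w ≤ n → Fin n
    fin {suc w} _ w<n = fromℕ< w<n

    pos : Fin n → ℕ
    pos x = suc (toℕ x)

    pos-fin : ∀ {w} (1≤w : 1 ≤ w) (w≤n : w ≤ n) → pos (fin 1≤w w≤n) ≡ w
    pos-fin {suc w} _ w<n = cong suc (toℕ-fromℕ< w<n)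

    πpos-bounded : ∀ x → 1 ≤ π (pos x) × π (pos x) ≤ n
    πpos-bounded x = proj₁ perm (pos x) (s≤s z≤n) (toℕ<n x)

    value : Fin n → Fin n
    value x = fin (proj₁ (πpos-bounded x)) (proj₂ (πpos-bounded x))

    pos-value : ∀ x → pos (value x) ≡ π (pos x)
    pos-value x = pos-fin (proj₁ (πpos-bounded x)) (proj₂ (πpos-bounded x))

    value-injective : ∀ {x y} → value x ≡ value y → x ≡ y
    value-injective {x} {y} value≡ = Finₚ.toℕ-injective (suc-injective
      (proj₂ perm (pos x) (pos y) (s≤s z≤n) (toℕ<n x) (s≤s z≤n) (toℕ<n y)
        (trans (sym (pos-value x)) (trans (cong pos value≡) (pos-value y)))))

  IsPerm-surjective : ∀ {v} → 1 ≤ v → v ≤ n → ∃[ x ] 1 ≤ x × x ≤ n × π x ≡ v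
  IsPerm-surjective 1≤v v≤n =
    let x , value≡v = Fin-injective⇒surjective value value-injective (fin 1≤v v≤n)
    in pos x , s≤s z≤n , toℕ<n x ,
       trans (sym (pos-value x)) (trans (cong pos value≡v) (pos-fin 1≤v v≤n))

IsArgmin : (ℕ → ℕ) → ℕ → ℕ → ℕ → Set
IsArgmin f lo hi r = lo ≤ r × r ≤ hi × (∀ t → lo ≤ t → t ≤ hi → f r ≤ f t)

aminFrom-isArgmin : ∀ f b k → IsArgmin f b (b + k) (aminFrom f b k)
aminFrom-isArgmin f b zero rewrite +-identityʳ b =
  ≤-refl , ≤-refl , λ t b≤t t≤b → ≤-reflexive (cong f (≤-antisym b≤t t≤b))
aminFrom-isArgmin f b (suc k) rewrite +-suc b k
  with aminFrom f (suc b) k | aminFrom-isArgmin f (suc b) k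
... | r | b<r , r≤hi , r-min with f r <ᵇ f b in fr<ᵇfb
...   | true  = <⇒≤ b<r , r≤hi , λ t b≤t t≤hi → case m≤n⇒m<n∨m≡n b≤t of λ where
                  (inj₁ b<t) → r-min t b<t t≤hi
                  (inj₂ refl) → <⇒≤ (<ᵇ⇒< (f r) (f b) (≡true⇒T fr<ᵇfb))
...   | false = ≤-refl , ≤-trans (<⇒≤ b<r) r≤hi ,
                λ t b≤t t≤hi → case m≤n⇒m<n∨m≡n b≤t of λ where
                  (inj₁ b<t) → ≤-trans (≮⇒≥ (≡false⇒¬T fr<ᵇfb ∘ <⇒<ᵇ)) (r-min t b<t t≤hi)
                  (inj₂ refl) → ≤-refl

argminRange-isArgmin : ∀ f {lo hi} → lo ≤ hi → IsArgmin f lo hi (argminRange f lo hi)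
argminRange-isArgmin f {lo} {hi} lo≤hi =
  subst (λ h → IsArgmin f lo h (aminFrom f lo (hi ∸ lo))) (m+[n∸m]≡n lo≤hi)
        (aminFrom-isArgmin f lo (hi ∸ lo))

Convex : (ℕ → Set) → Set
Convex M = ∀ {t₁ t₂ t₃} → t₁ ≤ t₂ → t₂ ≤ t₃ → M t₁ → M t₃ → M t₂

LeftEnd : (ℕ → Set) → ℕ → Set
LeftEnd M lo = (lo ≡ 1) ⊎ ¬ M (lo ∸ 1)

RightEnd : (ℕ → Set) → ℕ → ℕ → Set
RightEnd M N hi = (hi ≡ N) ⊎ ¬ M (suc hi)

module _ {M : ℕ → Set} (convex : Convex M) where

  LeftEnd⇒≤ : ∀ {lo t} → M lo → LeftEnd M lo → 1 ≤ t → M t → lo ≤ t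
  LeftEnd⇒≤ {lo} {t} M-lo lo-end 1≤t M-t with lo ≤? t | lo-end
  ... | yes lo≤t | _          = lo≤t
  ... | no  lo≰t | inj₁ refl  = contradiction 1≤t lo≰t
  ... | no  lo≰t | inj₂ ¬M-lo-1 =
    contradiction (convex (∸-monoˡ-≤ 1 (≰⇒> lo≰t)) (m∸n≤m lo 1) M-t M-lo) ¬M-lo-1

  RightEnd⇒≥ : ∀ {N hi t} → M hi → RightEnd M N hi → t ≤ N → M t → t ≤ hi
  RightEnd⇒≥ {N} {hi} {t} M-hi hi-end t≤N M-t with t ≤? hi | hi-end
  ... | yes t≤hi | _          = t≤hi
  ... | no  t≰hi | inj₁ refl  = contradiction t≤N t≰hi
  ... | no  t≰hi | inj₂ ¬M-hi+1 = contradiction (convex (n≤1+n hi) (≰⇒> t≰hi) M-hi M-t) ¬M-hi+1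

module Colex (T : List ℕ) where

  infix 4 _<colex_

  data _<colex_ : ℕ → ℕ → Set where
    ε<    : ∀ {q} → 0 <colex suc q
    last< : ∀ {p q} → at T (suc p) < at T (suc q) → suc p <colex suc q
    last≡ : ∀ {p q} → at T (suc p) ≡ at T (suc q) → p <colex q → suc p <colex suc q

  ColexLt⇒<colex : ∀ {p q} → ColexLt T p q → p <colex q
  ColexLt⇒<colex {zero}  {suc q} _ = ε<
  ColexLt⇒<colex {suc p} {suc q} lt with at T (suc p) <ᵇ at T (suc q) in <ᵇ≡
  ... | true = last< (<ᵇ⇒< _ _ (≡true⇒T <ᵇ≡))
  ... | false with at T (suc p) ≡ᵇ at T (suc q) in ≡ᵇ≡
  ...   | true = last≡ (≡ᵇ⇒≡ _ _ (≡true⇒T ≡ᵇ≡)) (ColexLt⇒<colex lt)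

  <colex-trans : ∀ {p q r} → p <colex q → q <colex r → p <colex r
  <colex-trans ε<          (last< _)   = ε<
  <colex-trans ε<          (last≡ _ _) = ε<
  <colex-trans (last< x)   (last< y)   = last< (<-trans x y)
  <colex-trans (last< x)   (last≡ y _) = last< (<-≤-trans x (≤-reflexive y))
  <colex-trans (last≡ x _) (last< y)   = last< (≤-<-trans (≤-reflexive x) y)
  <colex-trans (last≡ x p<q) (last≡ y q<r) = last≡ (trans x y) (<colex-trans p<q q<r)

  <colex⇒last≤ : ∀ {p q} → suc p <colex suc q → at T (suc p) ≤ at T (suc q)
  <colex⇒last≤ (last< x)   = <⇒≤ x
  <colex⇒last≤ (last≡ x _) = ≤-reflexive x

  SameSuffix : ℕ → ℕ → ℕ → Set
  SameSuffix p q ℓ = ∀ s → s < ℓ → at T (p ∸ s) ≡ at T (q ∸ s)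

  SameSuffix-<colex-convex : ∀ ℓ {p₁ p₂ p₃} → p₁ <colex p₂ → p₂ <colex p₃ → ℓ ≤ p₁ → ℓ ≤ p₃ →
                             SameSuffix p₁ p₃ ℓ → ℓ ≤ p₂ × SameSuffix p₁ p₂ ℓ
  SameSuffix-<colex-convex zero _ _ _ _ _ = z≤n , λ _ ()
  SameSuffix-<colex-convex (suc ℓ) (last< x) p₂<p₃ _ (s≤s _) same =
    contradiction (same 0 z<s) (<⇒≢ (<-≤-trans x (<colex⇒last≤ p₂<p₃)))
  SameSuffix-<colex-convex (suc ℓ) (last≡ x _) (last< y) _ _ same =
    contradiction (same 0 z<s) (<⇒≢ (≤-<-trans (≤-reflexive x) y))
  SameSuffix-<colex-convex (suc ℓ) (last≡ x p₁<p₂) (last≡ _ p₂<p₃) (s≤s ℓ≤p₁) (s≤s ℓ≤p₃) same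
    with SameSuffix-<colex-convex ℓ p₁<p₂ p₂<p₃ ℓ≤p₁ ℓ≤p₃ (λ s s<ℓ → same (suc s) (s≤s s<ℓ))
  ... | ℓ≤p₂ , same′ = s≤s ℓ≤p₂ , λ where
    zero    _         → x
    (suc s) (s≤s s<ℓ) → same′ s s<ℓ

m∸n+o≡m∸[n∸o] : ∀ {m n o} → n ≤ m → o ≤ n → m ∸ n + o ≡ m ∸ (n ∸ o)
m∸n+o≡m∸[n∸o] {m} {n} {o} n≤m o≤n = begin
  m ∸ n + o               ≡⟨ cong (m ∸ n +_) (m∸[m∸n]≡n o≤n) ⟨
  m ∸ n + (n ∸ (n ∸ o))   ≡⟨ +-∸-assoc (m ∸ n) (m∸n≤m n o) ⟨
  m ∸ n + n ∸ (n ∸ o)     ≡⟨ cong (_∸ (n ∸ o)) (m∸n+n≡m n≤m) ⟩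
  m ∸ (n ∸ o)             ∎
  where open ≡-Reasoning

module Suffixes (T : List ℕ) where
  open Colex T public

  -- T[1, p] ends with T[a, a + L - 1] · c; `SufMatch T D a b c t` unfolds to
  -- `SufMatchAt (at D t) a (suc b ∸ a) c`.
  SufMatchAt : ℕ → ℕ → ℕ → ℕ → Set
  SufMatchAt p a L c = (suc L ≤ p) × (at T p ≡ c) × (∀ k → k < L → at T (p ∸ L + k) ≡ at T (a + k))

  module _ {a L c : ℕ} where

    SufMatchAt⇒SameSuffix : ∀ {p q} → SufMatchAt p a L c → SufMatchAt q a L c → SameSuffix p q (suc L)
    SufMatchAt⇒SameSuffix (_ , p-last , _) (_ , q-last , _) zero _ = trans p-last (sym q-last)
    SufMatchAt⇒SameSuffix {p} {q} (L<p , _ , p-match) (L<q , _ , q-match) (suc s) (s≤s s<L) = begin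
      at T (p ∸ suc s)       ≡⟨ cong (at T) (back L<p) ⟨
      at T (p ∸ L + k)       ≡⟨ p-match k k<L ⟩
      at T (a + k)           ≡⟨ q-match k k<L ⟨
      at T (q ∸ L + k)       ≡⟨ cong (at T) (back L<q) ⟩
      at T (q ∸ suc s)       ∎
      where
      open ≡-Reasoning
      k = L ∸ suc s
      k<L : k < L
      k<L = ∸-monoʳ-< z<s s<L
      back : ∀ {r} → suc L ≤ r → r ∸ L + k ≡ r ∸ suc s
      back {r} L<r =
        trans (m∸n+o≡m∸[n∸o] (<⇒≤ L<r) (m∸n≤m L (suc s))) (cong (r ∸_) (m∸[m∸n]≡n s<L))

    SameSuffix⇒SufMatchAt : ∀ {p q} → SufMatchAt p a L c → suc L ≤ q → SameSuffix p q (suc L) →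
                            SufMatchAt q a L c
    SameSuffix⇒SufMatchAt {p} {q} (L<p , p-last , p-match) L<q same =
      L<q , trans (sym (same 0 z<s)) p-last , q-match
      where
      q-match : ∀ k → k < L → at T (q ∸ L + k) ≡ at T (a + k)
      q-match k k<L = begin
        at T (q ∸ L + k)       ≡⟨ cong (at T) (m∸n+o≡m∸[n∸o] (<⇒≤ L<q) (<⇒≤ k<L)) ⟩
        at T (q ∸ (L ∸ k))     ≡⟨ same (L ∸ k) (s≤s (m∸n≤m L k)) ⟨
        at T (p ∸ (L ∸ k))     ≡⟨ cong (at T) (m∸n+o≡m∸[n∸o] (<⇒≤ L<p) (<⇒≤ k<L)) ⟨
        at T (p ∸ L + k)       ≡⟨ p-match k k<L ⟩
        at T (a + k)           ∎
        where open ≡-Reasoning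

  SufMatch-convex : ∀ {D} → Linked (ColexLt T) D → ∀ {a b c} → Convex (SufMatch T D a b c)
  SufMatch-convex {D} sorted {t₁ = t₁} {t₂} {t₃} t₁≤t₂ t₂≤t₃ M₁ M₃
    with m≤n⇒m<n∨m≡n t₁≤t₂ | m≤n⇒m<n∨m≡n t₂≤t₃
  ... | inj₂ refl  | _          = M₁
  ... | _          | inj₂ refl  = M₃
  ... | inj₁ t₁<t₂ | inj₁ t₂<t₃ =
    let L<D[t₂] , same = SameSuffix-<colex-convex _
                           (order ≤-refl t₁<t₂ (<⇒≤ t₂<t₃)) (order t₁≤t₂ t₂<t₃ ≤-refl)
                           (proj₁ M₁) (proj₁ M₃) (SufMatchAt⇒SameSuffix M₁ M₃)
    in SameSuffix⇒SufMatchAt M₁ L<D[t₂] same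
    where
    1≤t₁ : 1 ≤ t₁
    1≤t₁ = proj₁ (at≢0⇒inBounds D (m<n⇒n≢0 (proj₁ M₁)))
    t₃≤∣D∣ : t₃ ≤ length D
    t₃≤∣D∣ = proj₂ (at≢0⇒inBounds D (m<n⇒n≢0 (proj₁ M₃)))
    order : ∀ {t t′} → t₁ ≤ t → t < t′ → t′ ≤ t₃ → at D t <colex at D t′
    order t₁≤t t<t′ t′≤t₃ =
      AllPairs-at (Linked⇒AllPairs <colex-trans (Linked.map (λ {p} {q} → ColexLt⇒<colex {p} {q}) sorted))
                  (≤-trans 1≤t₁ t₁≤t) t<t′ (≤-trans t′≤t₃ t₃≤∣D∣)

module CommonExtensions (T : List ℕ) where

  Agree : ℕ → ℕ → ℕ → Set
  Agree i j L = ∀ t → t < L → at T (i + t) ≡ at T (j + t)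

  lcpFuel-head : ∀ {f i j} → 0 < lcpFuel T f i j →
                 at T i ≡ at T j × lcpFuel T f i j ≡ suc (lcpFuel T (pred f) (suc i) (suc j))
  lcpFuel-head {suc f} {i} {j} 0<lcp
    with (0 <ᵇ i) ∧ (0 <ᵇ j) ∧ (i <ᵇ suc (length T)) ∧ (j <ᵇ suc (length T)) ∧ (at T i ≡ᵇ at T j)
         in guard
  ... | true = ≡ᵇ⇒≡ _ _ (T-∧ʳ (j <ᵇ suc (length T)) (T-∧ʳ (i <ᵇ suc (length T))
                 (T-∧ʳ (0 <ᵇ j) (T-∧ʳ (0 <ᵇ i) (≡true⇒T guard))))) , refl

  lcpFuel-suc : ∀ f {i j} → 1 ≤ i → 1 ≤ j → i ≤ length T → j ≤ length T → at T i ≡ at T j →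
                lcpFuel T (suc f) i j ≡ suc (lcpFuel T f (suc i) (suc j))
  lcpFuel-suc f 1≤i 1≤j i≤n j≤n T[i]≡T[j]
    rewrite T⇒≡true (<⇒<ᵇ 1≤i) | T⇒≡true (<⇒<ᵇ 1≤j)
          | T⇒≡true (<⇒<ᵇ (s≤s i≤n)) | T⇒≡true (<⇒<ᵇ (s≤s j≤n))
          | T⇒≡true (≡⇒≡ᵇ _ _ T[i]≡T[j]) = refl

  lcpFuel-agree : ∀ f i j t → t < lcpFuel T f i j → at T (i + t) ≡ at T (j + t)
  lcpFuel-agree f i j zero 0<lcp rewrite +-identityʳ i | +-identityʳ j = proj₁ (lcpFuel-head {f} 0<lcp)
  lcpFuel-agree f i j (suc t) t<lcp rewrite +-suc i t | +-suc j t =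
    let _ , lcp≡ = lcpFuel-head {f} {i} {j} (≤-<-trans z≤n t<lcp)
    in lcpFuel-agree (pred f) (suc i) (suc j) t (s≤s⁻¹ (subst (suc t <_) lcp≡ t<lcp))

  Agree-head : ∀ {x y L} → Agree x y (suc L) → at T x ≡ at T y
  Agree-head {x} {y} agree = subst₂ (λ u v → at T u ≡ at T v) (+-identityʳ x) (+-identityʳ y) (agree 0 z<s)

  Agree-tail : ∀ {x y L} → Agree x y (suc L) → Agree (suc x) (suc y) L
  Agree-tail {x} {y} agree t t<L =
    subst₂ (λ u v → at T u ≡ at T v) (+-suc x t) (+-suc y t) (agree (suc t) (s≤s t<L))

  lcpFuel-≥ : ∀ {f i j L} → L ≤ f → 1 ≤ i → 1 ≤ j →
              i + L ≤ suc (length T) → j + L ≤ suc (length T) → Agree i j L → L ≤ lcpFuel T f i j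
  lcpFuel-≥ {L = zero} _ _ _ _ _ _ = z≤n
  lcpFuel-≥ {suc f} {i} {j} {suc L} (s≤s L≤f) 1≤i 1≤j i+L<n+1 j+L<n+1 agree =
    subst (suc L ≤_) (sym (lcpFuel-suc f 1≤i 1≤j (in-text i+L<n+1) (in-text j+L<n+1) (Agree-head agree)))
      (s≤s (lcpFuel-≥ L≤f z<s z<s (tail-fits i+L<n+1) (tail-fits j+L<n+1) (Agree-tail agree)))
    where
    tail-fits : ∀ {x} → x + suc L ≤ suc (length T) → suc x + L ≤ suc (length T)
    tail-fits {x} = subst (_≤ suc (length T)) (+-suc x L)

    in-text : ∀ {x} → x + suc L ≤ suc (length T) → x ≤ length T
    in-text {x} fits = ≤-trans (m≤m+n x L) (s≤s⁻¹ (tail-fits fits))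

  rlce-agree : ∀ {i j L} → L ≤ rlce T i j → Agree i j L
  rlce-agree {i} {j} L≤rlce t t<L = lcpFuel-agree (length T) i j t (<-≤-trans t<L L≤rlce)

  rlce-≥ : ∀ {i j L} → 1 ≤ i → 1 ≤ j → i + L ≤ suc (length T) → j + L ≤ suc (length T) →
           Agree i j L → L ≤ rlce T i j
  rlce-≥ {i} {L = L} 1≤i 1≤j i+L≤n+1 =
    lcpFuel-≥ (s≤s⁻¹ (≤-trans (+-monoˡ-≤ L 1≤i) i+L≤n+1)) 1≤i 1≤j i+L≤n+1

  module _ {π : ℕ → ℕ} where

    LPF-≡ : ∀ {x y ℓ} → π x ≢ 1 → 1 ≤ y → y ≤ length T → π y < π x → ℓ ≤ rlce T y x →
            (∀ z → 1 ≤ z → z ≤ length T → π z < π x → rlce T z x ≤ ℓ) → LPF T π x ≡ ℓ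
    LPF-≡ {x} {y} {ℓ} πx≢1 1≤y y≤n πy<πx ℓ≤rlce rlce≤ℓ with π x ≡ᵇ 1 in πx≡ᵇ1
    ... | true  = contradiction (≡ᵇ⇒≡ _ _ (≡true⇒T πx≡ᵇ1)) πx≢1
    ... | false = ≤-antisym
      (maxList-lub (Allₚ.map⁺ (All.tabulate λ z∈ → bounded (∈-range1⁻ z∈))))
      (≤-trans (subst (ℓ ≤_) (sym candidate-y) ℓ≤rlce)
               (≤-maxList (∈-map⁺ candidate (∈-range1⁺ 1≤y y≤n))))
      where
      candidate : ℕ → ℕ
      candidate z = if π z <ᵇ π x then rlce T z x else 0

      candidate-y : candidate y ≡ rlce T y x
      candidate-y rewrite T⇒≡true (<⇒<ᵇ πy<πx) = refl

      bounded : ∀ {z} → 1 ≤ z × z ≤ length T → candidate z ≤ ℓ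
      bounded {z} (1≤z , z≤∣T∣) with π z <ᵇ π x in πz<ᵇπx
      ... | true  = rlce≤ℓ z 1≤z z≤∣T∣ (<ᵇ⇒< _ _ (≡true⇒T πz<ᵇπx))
      ... | false = z≤n

    OrderPreserving-shift : OrderPreserving T π → ∀ {x y} ℓ → 1 ≤ x → 1 ≤ y →
                            x + ℓ ≤ length T → y + ℓ ≤ length T → Agree x y (suc ℓ) →
                            π x < π y → π (x + ℓ) < π (y + ℓ)
    OrderPreserving-shift op {x} {y} zero _ _ _ _ _ πx<πy =
      subst₂ (λ u v → π u < π v) (sym (+-identityʳ x)) (sym (+-identityʳ y)) πx<πy
    OrderPreserving-shift op {x} {y} (suc ℓ) 1≤x 1≤y x+ℓ≤n y+ℓ≤n agree πx<πy =
      subst₂ (λ u v → π u < π v) (sym (+-suc x ℓ)) (sym (+-suc y ℓ))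
        (OrderPreserving-shift op ℓ z<s z<s (tail-fits x+ℓ≤n) (tail-fits y+ℓ≤n) (Agree-tail agree)
          (op x y 1≤x (before-last x+ℓ≤n) 1≤y (before-last y+ℓ≤n) πx<πy
              (Agree-head agree) (Agree-head (Agree-tail agree))))
      where
      tail-fits : ∀ {u} → u + suc ℓ ≤ length T → suc u + ℓ ≤ length T
      tail-fits {u} = subst (_≤ length T) (+-suc u ℓ)

      before-last : ∀ {u} → u + suc ℓ ≤ length T → u ≤ length T ∸ 1
      before-last {u} fits = ∸-monoˡ-≤ 1 (≤-trans (s≤s (m≤m+n u ℓ)) (tail-fits fits))

module Search (T : List ℕ) (π : ℕ → ℕ) (D : List ℕ) (ss : ℕ → ℕ → ℕ → ℕ × ℕ) (P : List ℕ)
              (text : IsText T) (perm : IsPerm (length T) π) (order-preserving : OrderPreserving T π)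
              (P≢$ : All (λ c → c ≢ 0) P) (pda : IsPDA T π D) (sufsearch : SufSearchSpec T D ss) where

  open Algorithm T π D ss P
  open Suffixes T
  open CommonExtensions T

  n : ℕ
  n = length T

  -- `PrefixOcc m` is `Occ T P` and `MinPrefixOcc m` is `MinOcc T π P`.
  PrefixOcc : ℕ → ℕ → Set
  PrefixOcc j k = (1 ≤ k) × (k ≤ n) × (k + j ≤ suc n) × (∀ t → t < j → at T (k + t) ≡ at P (suc t))

  MinPrefixOcc : ℕ → ℕ → Set
  MinPrefixOcc j k = PrefixOcc j k × (∀ k′ → PrefixOcc j k′ → π k ≤ π k′)

  PrefixOcc? : ∀ j k → Dec (PrefixOcc j k)
  PrefixOcc? j k = (1 ≤? k) ×-dec (k ≤? n) ×-dec (k + j ≤? suc n) ×-dec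
    map′ (λ agree t → agree {t}) (λ agree {t} → agree t) (allUpTo? (λ t → at T (k + t) ≟ at P (suc t)) j)

  PrefixOcc-≤ : ∀ {j j′ k} → j′ ≤ j → PrefixOcc j k → PrefixOcc j′ k
  PrefixOcc-≤ {k = k} j′≤j (1≤k , k≤n , fits , agree) =
    1≤k , k≤n , ≤-trans (+-monoʳ-≤ k j′≤j) fits , λ t t<j′ → agree t (<-≤-trans t<j′ j′≤j)

  -- P contains no $, so a nonempty match of a prefix of P lies inside T.
  matching⇒PrefixOcc : ∀ {j k} → 1 ≤ j → j ≤ m → 1 ≤ k →
                       (∀ t → t < j → at T (k + t) ≡ at P (suc t)) → PrefixOcc j k
  matching⇒PrefixOcc {suc j} {k} _ j<m 1≤k agree =
    1≤k , ≤-trans (m≤m+n k j) last≤n , subst (_≤ suc n) (sym (+-suc k j)) (s≤s last≤n) , agree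
    where
    last≤n : k + j ≤ n
    last≤n = proj₂ (at≢0⇒inBounds T λ T[k+j]≡0 →
      All.lookup P≢$ (at-∈ P (s≤s z≤n) j<m) (trans (sym (agree j ≤-refl)) T[k+j]≡0))

  PrefixOcc-last : ∀ {j k} → PrefixOcc (suc j) k → k + j ≤ n
  PrefixOcc-last {j} {k} (_ , _ , fits , _) = s≤s⁻¹ (subst (_≤ suc n) (+-suc k j) fits)

  PrefixOcc-agree : ∀ {j x y} → PrefixOcc j x → PrefixOcc j y → Agree x y j
  PrefixOcc-agree (_ , _ , _ , x-agree) (_ , _ , _ , y-agree) t t<j = trans (x-agree t t<j) (sym (y-agree t t<j))

  MinPrefixOcc-exists : ∀ {j K} → PrefixOcc j K → ∃ (MinPrefixOcc j)
  MinPrefixOcc-exists {j} {K} occ-K = k , argmin-all π occ-K (Allₚ.all-filter (PrefixOcc? j) (range1 n)) , minimal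
    where
    candidates : List ℕ
    candidates = filter (PrefixOcc? j) (range1 n)

    k : ℕ
    k = argmin π K candidates

    minimal : ∀ k′ → PrefixOcc j k′ → π k ≤ π k′
    minimal k′ occ@(1≤k′ , k′≤n , _) =
      All.lookup (f[argmin]≤f[xs] K candidates) (∈-filter⁺ (PrefixOcc? j) (∈-range1⁺ 1≤k′ k′≤n) occ)

  π-bounded : ∀ {x} → 1 ≤ x → x ≤ n → 1 ≤ π x × π x ≤ n
  π-bounded = proj₁ perm _

  π-injective : ∀ {x y} → 1 ≤ x → x ≤ n → 1 ≤ y → y ≤ n → π x ≡ π y → x ≡ y
  π-injective = proj₂ perm _ _

  MinPrefixOcc-0 : MinPrefixOcc 0 (preimage π n 1)
  MinPrefixOcc-0 with IsPerm-surjective perm ≤-refl (proj₁ text)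
  ... | x , 1≤x , x≤n , πx≡1 with preimage-spec π n 1 1≤x x≤n πx≡1
  ... | 1≤k , k≤n , πk≡1 =
    (1≤k , k≤n , m≤n⇒m≤1+n (subst (_≤ n) (sym (+-identityʳ _)) k≤n) , λ _ ()) ,
    λ k′ (1≤k′ , k′≤n , _) → subst (_≤ π k′) (sym πk≡1) (proj₁ (π-bounded 1≤k′ k′≤n))

  MinPrefixOcc-match : ∀ {j k} → j < m → MinPrefixOcc j k → at T (k + j) ≡ at P (suc j) →
                       MinPrefixOcc (suc j) k
  MinPrefixOcc-match {j} {k} j<m ((1≤k , _ , _ , agree) , minimal) T[k+j]≡P[j+1] =
    matching⇒PrefixOcc z<s j<m 1≤k agree′ , λ k′ occ → minimal k′ (PrefixOcc-≤ (n≤1+n j) occ)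
    where
    agree′ : ∀ t → t < suc j → at T (k + t) ≡ at P (suc t)
    agree′ t t<j+1 with m≤n⇒m<n∨m≡n (s≤s⁻¹ t<j+1)
    ... | inj₁ t<j  = agree t t<j
    ... | inj₂ refl = T[k+j]≡P[j+1]

  PrefixOcc⇒SufMatchAt : ∀ {j k q} → PrefixOcc j k → PrefixOcc (suc j) q →
                         SufMatchAt (q + j) k j (at P (suc j))
  PrefixOcc⇒SufMatchAt {j} {k} {q} (_ , _ , _ , k-agree) (1≤q , _ , _ , q-agree) =
    +-monoˡ-≤ j 1≤q , q-agree j ≤-refl , λ t t<j → begin
      at T (q + j ∸ j + t)   ≡⟨ cong (λ u → at T (u + t)) (m+n∸n≡m q j) ⟩
      at T (q + t)           ≡⟨ q-agree t (m≤n⇒m≤1+n t<j) ⟩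
      at P (suc t)           ≡⟨ k-agree t t<j ⟨
      at T (k + t)           ∎
    where open ≡-Reasoning

  SufMatchAt⇒PrefixOcc : ∀ {j k p} → j < m → PrefixOcc j k → SufMatchAt p k j (at P (suc j)) →
                         PrefixOcc (suc j) (p ∸ j)
  SufMatchAt⇒PrefixOcc {j} {k} {p} j<m (_ , _ , _ , k-agree) (j<p , T[p]≡P[j+1] , match) =
    matching⇒PrefixOcc z<s j<m (m<n⇒0<n∸m j<p) agree
    where
    agree : ∀ t → t < suc j → at T (p ∸ j + t) ≡ at P (suc t)
    agree t t<j+1 with m≤n⇒m<n∨m≡n (s≤s⁻¹ t<j+1)
    ... | inj₁ t<j  = trans (match t t<j) (k-agree t t<j)
    ... | inj₂ refl = trans (cong (at T) (m∸n+n≡m (<⇒≤ j<p))) T[p]≡P[j+1]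

  -- `jump (k + j) (suc j)` asks sufsearch for the window T[k, k + j - 1].
  window-start : ∀ k j → k + j ∸ j ≡ k
  window-start = m+n∸n≡m

  window-length : ∀ {k} j → 1 ≤ k → suc (k + j ∸ 1) ∸ (k + j ∸ j) ≡ j
  window-length {suc k} j _ = trans (cong (suc k + j ∸_) (window-start (suc k) j)) (m+n∸m≡n (suc k) j)

  module Mismatch {j k k′} (j<m : j < m) (min-k : MinPrefixOcc j k) (min-k′ : MinPrefixOcc (suc j) k′)
                  (mismatch : at T (k + j) ≢ at P (suc j)) where

    occ-k : PrefixOcc j k
    occ-k = proj₁ min-k

    occ-k′ : PrefixOcc (suc j) k′
    occ-k′ = proj₁ min-k′

    1≤k : 1 ≤ k
    1≤k = proj₁ occ-k

    k≤n : k ≤ n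
    k≤n = proj₁ (proj₂ occ-k)

    1≤k′ : 1 ≤ k′
    1≤k′ = proj₁ occ-k′

    k′≤n : k′ ≤ n
    k′≤n = proj₁ (proj₂ occ-k′)

    πk<πk′ : π k < π k′
    πk<πk′ = ≤∧≢⇒< (proj₂ min-k k′ (PrefixOcc-≤ (n≤1+n j) occ-k′)) λ πk≡πk′ →
      mismatch (subst (λ x → at T (x + j) ≡ at P (suc j))
                      (sym (π-injective 1≤k k≤n 1≤k′ k′≤n πk≡πk′))
                      (proj₂ (proj₂ (proj₂ occ-k′)) j ≤-refl))

    -- k witnesses LPF ≥ j; a longer earlier factor would be an occurrence of P[1, j + 1]
    -- preceding k′ in π.
    LPF[k′]≡j : LPF T π k′ ≡ j
    LPF[k′]≡j = LPF-≡ πk′≢1 1≤k k≤n πk<πk′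
      (rlce-≥ 1≤k 1≤k′ (proj₁ (proj₂ (proj₂ occ-k)))
              (≤-trans (+-monoʳ-≤ k′ (n≤1+n j)) (proj₁ (proj₂ (proj₂ occ-k′))))
              (PrefixOcc-agree occ-k (PrefixOcc-≤ (n≤1+n j) occ-k′)))
      rlce≤j
      where
      πk′≢1 : π k′ ≢ 1
      πk′≢1 πk′≡1 = <⇒≱ (subst (π k <_) πk′≡1 πk<πk′) (proj₁ (π-bounded 1≤k k≤n))

      rlce≤j : ∀ z → 1 ≤ z → z ≤ n → π z < π k′ → rlce T z k′ ≤ j
      rlce≤j z 1≤z _ πz<πk′ = ≮⇒≥ λ j<rlce → <⇒≱ πz<πk′ (proj₂ min-k′ z
        (matching⇒PrefixOcc z<s j<m 1≤z λ t t≤j →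
          trans (rlce-agree j<rlce t t≤j) (proj₂ (proj₂ (proj₂ occ-k′)) t t≤j)))

    end∈D : k′ + j ∈ D
    end∈D = subst (λ ℓ → k′ + ℓ ∈ D) LPF[k′]≡j (proj₂ (proj₂ pda) k′ 1≤k′ k′≤n)

    c : ℕ
    c = at P (suc j)

    Matches : ℕ → Set
    Matches = SufMatch T D (k + j ∸ j) (k + j ∸ 1) c

    Matches⇒SufMatchAt : ∀ {t} → Matches t → SufMatchAt (at D t) k j c
    Matches⇒SufMatchAt = subst₂ (λ a L → SufMatchAt _ a L c) (window-start k j) (window-length j 1≤k)

    end-Matches : ∀ {t} → at D t ≡ k′ + j → Matches t
    end-Matches D[t]≡k′+j =
      subst₂ (λ a L → SufMatchAt _ a L c) (sym (window-start k j)) (sym (window-length j 1≤k))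
      (subst (λ p → SufMatchAt p k j c) (sym D[t]≡k′+j) (PrefixOcc⇒SufMatchAt occ-k occ-k′))

    lo hi r : ℕ
    lo = proj₁ (ss (k + j ∸ j) (k + j ∸ 1) c)
    hi = proj₂ (ss (k + j ∸ j) (k + j ∸ 1) c)
    r = argminRange (λ t → π (at D t)) lo hi

    lo≤hi : lo ≤ hi
    lo≤hi = proj₁ (proj₂ (sufsearch _ _ c))

    window-maximal : (∀ t → lo ≤ t → t ≤ hi → Matches t)
                     × LeftEnd Matches lo × RightEnd Matches (length D) hi
    window-maximal = proj₂ (proj₂ (proj₂ (sufsearch _ _ c)))
      (subst (1 ≤_) (sym (window-start k j)) 1≤k)
      (subst (_≤ suc (k + j ∸ 1)) (sym (window-start k j)) (≤-trans (m≤m+n k j) (m≤n+m∸n (k + j) 1)))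
      (∸-monoˡ-≤ 1 (proj₁ (proj₂ (proj₂ occ-k))))
      (let t , 1≤t , t≤∣D∣ , D[t]≡k′+j = ∈⇒at end∈D
       in t , 1≤t , t≤∣D∣ , end-Matches D[t]≡k′+j)

    Matches-convex : Convex Matches
    Matches-convex = SufMatch-convex (proj₁ pda)

    end-in-window : ∃[ t ] at D t ≡ k′ + j × lo ≤ t × t ≤ hi
    end-in-window =
      let t , 1≤t , t≤∣D∣ , D[t]≡k′+j = ∈⇒at end∈D
          all , lo-end , hi-end = window-maximal
      in t , D[t]≡k′+j ,
         LeftEnd⇒≤ Matches-convex (all lo ≤-refl lo≤hi) lo-end 1≤t (end-Matches D[t]≡k′+j) ,
         RightEnd⇒≥ Matches-convex (all hi lo≤hi ≤-refl) hi-end t≤∣D∣ (end-Matches D[t]≡k′+j)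

    r-isArgmin : IsArgmin (λ t → π (at D t)) lo hi r
    r-isArgmin = argminRange-isArgmin (λ t → π (at D t)) lo≤hi

    π[D[r]]≤π[k′+j] : π (at D r) ≤ π (k′ + j)
    π[D[r]]≤π[k′+j] =
      let t , D[t]≡k′+j , lo≤t , t≤hi = end-in-window
      in subst (λ p → π (at D r) ≤ π p) D[t]≡k′+j (proj₂ (proj₂ r-isArgmin) t lo≤t t≤hi)

    D[r]-Matches : Matches r
    D[r]-Matches = proj₁ window-maximal r (proj₁ r-isArgmin) (proj₁ (proj₂ r-isArgmin))

    -- p = d + j for an occurrence d of P[1, j + 1], and order preservation carries π k′ < π d
    -- along the common factor.
    end-π-least : ∀ {p} → SufMatchAt p k j c → p ≢ k′ + j → π (k′ + j) < π p
    end-π-least {p} match p≢k′+j =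
      subst (λ u → π (k′ + j) < π u) (m∸n+n≡m (<⇒≤ (proj₁ match)))
        (OrderPreserving-shift order-preserving j 1≤k′ (proj₁ occ-d) (PrefixOcc-last occ-k′)
          (PrefixOcc-last occ-d) (PrefixOcc-agree occ-k′ occ-d) πk′<πd)
      where
      occ-d : PrefixOcc (suc j) (p ∸ j)
      occ-d = SufMatchAt⇒PrefixOcc j<m occ-k match

      πk′<πd : π k′ < π (p ∸ j)
      πk′<πd = ≤∧≢⇒< (proj₂ min-k′ (p ∸ j) occ-d) λ πk′≡πd → p≢k′+j (begin
        p              ≡⟨ m∸n+n≡m (<⇒≤ (proj₁ match)) ⟨
        p ∸ j + j      ≡⟨ cong (_+ j) (π-injective (proj₁ occ-d) (proj₁ (proj₂ occ-d)) 1≤k′ k′≤n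
                                                     (sym πk′≡πd)) ⟩
        k′ + j         ∎)
        where open ≡-Reasoning

    jump≡ : jump (k + j) (suc j) ≡ k′ + j
    jump≡ = decidable-stable (at D r ≟ k′ + j) λ D[r]≢k′+j →
      <⇒≱ (end-π-least (Matches⇒SufMatchAt D[r]-Matches) D[r]≢k′+j) π[D[r]]≤π[k′+j]

  step-≡ : ∀ {j k K} → j < m → MinPrefixOcc j k → PrefixOcc m K →
           ∃[ k′ ] MinPrefixOcc (suc j) k′ × step (k + j) (suc j) ≡ k′ + suc j
  step-≡ {j} {k} j<m min-k occ-K with at T (k + j) ≡ᵇ at P (suc j) in T[k+j]≡ᵇP[j+1]
  ... | true  = k , MinPrefixOcc-match j<m min-k (≡ᵇ⇒≡ _ _ (≡true⇒T T[k+j]≡ᵇP[j+1])) , sym (+-suc k j)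
  ... | false =
    let k′ , min-k′ = MinPrefixOcc-exists (PrefixOcc-≤ j<m occ-K)
        mismatch = ≡false⇒¬T T[k+j]≡ᵇP[j+1] ∘ ≡⇒≡ᵇ _ _
    in k′ , min-k′ , trans (cong suc (Mismatch.jump≡ j<m min-k min-k′ mismatch)) (sym (+-suc k′ j))

  loop-≡ : ∀ {K} r {i j k} → PrefixOcc m K → j + r ≡ m → i ≡ k + j → MinPrefixOcc j k →
           ∃[ k* ] MinPrefixOcc m k* × loop r i (suc j) ≡ k* + m
  loop-≡ zero {j = j} _ j+0≡m refl min-k with trans (sym (+-identityʳ j)) j+0≡m
  ... | refl = _ , min-k , refl
  loop-≡ (suc r) {j = j} occ-K j+r+1≡m refl min-k =
    let k′ , min-k′ , step≡ = step-≡ (subst (j <_) j+r+1≡m (m<m+n j z<s)) min-k occ-K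
    in loop-≡ r occ-K (trans (sym (+-suc j r)) j+r+1≡m) step≡ min-k′

  -- `result` is `decide finalI`.
  decide : ℕ → Maybe ℕ
  decide i = if (m <ᵇ i) ∧ matchesAt (i ∸ m) then just (i ∸ m) else nothing

  matchesAt⇔ : ∀ k → Bool.T (matchesAt k) ⇔ (∀ t → t < m → at T (k + t) ≡ at P (suc t))
  matchesAt⇔ k = mk⇔
    (λ ok t t<m → ≡ᵇ⇒≡ _ _ (All.lookup (Allₚ.all⁺ _ (upTo m) ok) (∈-upTo⁺ t<m)))
    (λ agree → Allₚ.all⁻ _ (All.tabulate λ t∈ → ≡⇒≡ᵇ _ _ (agree _ (∈-upTo⁻ t∈))))

  decide-just : ∀ {k} → Occ T P k → decide (k + m) ≡ just k
  decide-just {k} (1≤k , _ , _ , agree)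
    rewrite m+n∸n≡m k m | T⇒≡true (<⇒<ᵇ (+-monoˡ-≤ m 1≤k))
          | T⇒≡true (Equivalence.from (matchesAt⇔ k) agree) = refl

  Occ-empty : m ≤ 0 → Occ T P 1
  Occ-empty m≤0 =
    ≤-refl , proj₁ text , s≤s (≤-trans m≤0 z≤n) , λ t t<m → contradiction (<-≤-trans t<m m≤0) λ ()

  decide-nothing : ¬ ∃ (Occ T P) → ∀ i → decide i ≡ nothing
  decide-nothing ∄occ i with (m <ᵇ i) ∧ matchesAt (i ∸ m) in accepted
  ... | false = refl
  ... | true with 1 ≤? m
  ...   | no  1≰m = contradiction (1 , Occ-empty (≮⇒≥ 1≰m)) ∄occ
  ...   | yes 1≤m = contradiction (i ∸ m , matching⇒PrefixOcc 1≤m ≤-refl (m<n⇒0<n∸m m<i) agree) ∄occ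
    where
    m<i : m < i
    m<i = <ᵇ⇒< m i (T-∧ˡ (≡true⇒T accepted))
    agree : ∀ t → t < m → at T (i ∸ m + t) ≡ at P (suc t)
    agree = Equivalence.to (matchesAt⇔ (i ∸ m)) (T-∧ʳ (m <ᵇ i) (≡true⇒T accepted))

lemma31 : (T : List ℕ) (π : ℕ → ℕ) (D : List ℕ) (ss : ℕ → ℕ → ℕ → ℕ × ℕ) (P : List ℕ) →
          IsText T → IsPerm (length T) π → OrderPreserving T π →
          All (λ c → c ≢ 0) P → IsPDA T π D → SufSearchSpec T D ss →
          ((Σ ℕ (λ k → Occ T P k)) → Σ ℕ (λ k → MinOcc T π P k × Algorithm.result T π D ss P ≡ just k))
          × ((¬ Σ ℕ (λ k → Occ T P k)) → Algorithm.result T π D ss P ≡ nothing)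
lemma31 T π D ss P text perm order-preserving P≢$ pda sufsearch = found , not-found
  where
  open Algorithm T π D ss P using (m; finalI)
  open Search T π D ss P text perm order-preserving P≢$ pda sufsearch

  found : ∃ (Occ T P) → ∃[ k ] MinOcc T π P k × decide finalI ≡ just k
  found (K , occ-K) =
    let k , min-k , finalI≡k+m = loop-≡ m occ-K refl (sym (+-identityʳ _)) MinPrefixOcc-0
    in k , min-k , trans (cong decide finalI≡k+m) (decide-just (proj₁ min-k))

  not-found : ¬ ∃ (Occ T P) → decide finalI ≡ nothing
  not-found ∄occ = decide-nothing ∄occ finalI
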